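{- Let $X$ be a family of sets closed under finite intersections and $Y$ a family of sets closed under finite unions with least element $\overline0$. Let $\theta:X\to Y$ be a bijection such that: - for all $A,B,C\in X$: $A\cap\theta^{ -1}(\theta(B)\cup\theta(C))=\theta^{ -1}(\theta(A\cap B)\cup\theta(A\cap C))$; - for all $P,Q,R\in Y$: $P\cup\theta(\theta^{ -1}(Q)\cap\theta^{ -1}(R))=\theta(\theta^{ -1}(P\cup Q)\cap\theta^{ -1}(P\cup R))$. Let ${}^\star:Y\to X$ be an inclusion-reversing order isomorphism with ${}^\star\circ\theta=\theta^{ -1}\circ({}^\star)^{ -1}$. For $A,B\in X$ define $A+B=\theta^{ -1}(\theta(A)\cup\theta(B))$, $A\cdot B=A\cap B$, $A^\dagger=(\theta(A))^\star$, $\bot=\theta^{ -1}(\overline0)$ and $\top=\overline0^\star$. Then $\langle X,\cdot,+,{}^\dagger,\bot,\top\rangle$ is a De Morgan bisemilattice.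
   Context: A De Morgan bisemilattice is an algebra $\langle A,\land,\lor,',0,1\rangle$ such that: - $\land,\lor$ are idempotent, commutative and associative, and each distributes over the other; - $x\land1=x$, $x\lor0=x$ and $x''=x$; - $(x\land y)'=x'\lor y'$ and $(x\lor y)'=x'\land y'$. -}

module Defs where

open import Level using (Level; 0ℓ; _⊔_; suc)
open import Data.Product using (Σ; _,_; proj₁; proj₂; _×_)
open import Relation.Unary using (Pred; _⊆_; _∩_; _∪_; _≐_)
open import Relation.Unary.Properties using (≐-refl; ≐-sym; ≐-trans)
open import Relation.Binary.Core using (Rel)
open import Relation.Binary.Bundles using (Setoid)
open import Relation.Binary.Structures using (IsEquivalence)

Family : Set → Set₁
Family U = Pred (Pred U 0ℓ) 0ℓ

Member : {U : Set} → Family U → Set₁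
Member {U} F = Σ (Pred U 0ℓ) F

_≈ₘ_ : {U : Set} {F : Family U} → Member F → Member F → Set
a ≈ₘ b = proj₁ a ≐ proj₁ b

_⊆ₘ_ : {U : Set} {F : Family U} → Member F → Member F → Set
a ⊆ₘ b = proj₁ a ⊆ proj₁ b

MemberSetoid : {U : Set} → Family U → Setoid (suc 0ℓ) 0ℓ
MemberSetoid F = record
  { Carrier = Member F
  ; _≈_ = _≈ₘ_
  ; isEquivalence = record { refl = ≐-refl ; sym = ≐-sym ; trans = ≐-trans } }

-- Closure under (binary, hence all nonempty finite) intersections / unions.
ClosedUnder∩ : {U : Set} → Family U → Set₁
ClosedUnder∩ F = ∀ {A B} → F A → F B → F (A ∩ B)

ClosedUnder∪ : {U : Set} → Family U → Set₁
ClosedUnder∪ F = ∀ {A B} → F A → F B → F (A ∪ B)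

IsLeast : {U : Set} → Family U → Pred U 0ℓ → Set₁
IsLeast F o = F o × (∀ {P} → F P → o ⊆ P)

meet : {U : Set} {F : Family U} → ClosedUnder∩ F → Member F → Member F → Member F
meet c a b = (proj₁ a ∩ proj₁ b , c (proj₂ a) (proj₂ b))

join : {U : Set} {F : Family U} → ClosedUnder∪ F → Member F → Member F → Member F
join c a b = (proj₁ a ∪ proj₁ b , c (proj₂ a) (proj₂ b))

record IsDeMorganBisemilattice {a ℓ : Level} {A : Set a} (_≈_ : Rel A ℓ)
    (_∧_ _∨_ : A → A → A) (_′ : A → A) (𝟘 𝟙 : A) : Set (a ⊔ ℓ) where
  field
    isEquivalence : IsEquivalence _≈_
    ∧-cong : ∀ {x y u v} → x ≈ y → u ≈ v → (x ∧ u) ≈ (y ∧ v)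
    ∨-cong : ∀ {x y u v} → x ≈ y → u ≈ v → (x ∨ u) ≈ (y ∨ v)
    ′-cong : ∀ {x y} → x ≈ y → (x ′) ≈ (y ′)
    ∧-idem : ∀ x → (x ∧ x) ≈ x
    ∨-idem : ∀ x → (x ∨ x) ≈ x
    ∧-comm : ∀ x y → (x ∧ y) ≈ (y ∧ x)
    ∨-comm : ∀ x y → (x ∨ y) ≈ (y ∨ x)
    ∧-assoc : ∀ x y z → ((x ∧ y) ∧ z) ≈ (x ∧ (y ∧ z))
    ∨-assoc : ∀ x y z → ((x ∨ y) ∨ z) ≈ (x ∨ (y ∨ z))
    ∧-distrib-∨ : ∀ x y z → (x ∧ (y ∨ z)) ≈ ((x ∧ y) ∨ (x ∧ z))
    ∨-distrib-∧ : ∀ x y z → (x ∨ (y ∧ z)) ≈ ((x ∨ y) ∧ (x ∨ z))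
    ∧-identity : ∀ x → (x ∧ 𝟙) ≈ x
    ∨-identity : ∀ x → (x ∨ 𝟘) ≈ x
    ′-involutive : ∀ x → ((x ′) ′) ≈ x
    deMorgan-∧ : ∀ x y → ((x ∧ y) ′) ≈ ((x ′) ∨ (y ′))
    deMorgan-∨ : ∀ x y → ((x ∨ y) ′) ≈ ((x ′) ∧ (y ′))

module Submission where

-- The operations on X come from two sources: the meet A · B is
-- plain intersection, while the join A + B = θ⁻¹(θ A ∪ θ B) is union in Y
-- transported along the bijection θ, and A† = (θ A)⋆.
-- The theorem then only assembles the axioms of a De Morgan bisemilattice;
-- the first distributive law is literally the first hypothesis.

open import Defs
open import Level using (0ℓ)
open import Data.Product using (_,_; proj₁; proj₂; _×_)
open import Data.Sum using (inj₁; inj₂; [_,_]′; swap)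
open import Relation.Unary using (Pred)
open import Relation.Unary.Properties using (≐-refl; ≐-sym; ≐-trans)
open import Relation.Binary.Bundles using (Setoid)
open import Function.Base using (_∘_; id)
open import Function.Bundles using (Inverse)
import Relation.Binary.Reasoning.Setoid as SetoidReasoning

module Intersection {U : Set} {X : Family U} (∩X : ClosedUnder∩ X) where
  private
    _∧_ : Member X → Member X → Member X
    _∧_ = meet ∩X
    _≈_ : Member X → Member X → Set
    _≈_ = _≈ₘ_

  ∧-cong : ∀ A B C D → A ≈ B → C ≈ D → (A ∧ C) ≈ (B ∧ D)
  ∧-cong _ _ _ _ (A⊆B , B⊆A) (C⊆D , D⊆C) =
    (λ (a , c) → A⊆B a , C⊆D c) , (λ (b , d) → B⊆A b , D⊆C d)

  ∧-idem : ∀ A → (A ∧ A) ≈ A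
  ∧-idem A = proj₁ , λ a → a , a

  ∧-comm : ∀ A B → (A ∧ B) ≈ (B ∧ A)
  ∧-comm A B = (λ (a , b) → b , a) , (λ (b , a) → a , b)

  ∧-assoc : ∀ A B C → ((A ∧ B) ∧ C) ≈ (A ∧ (B ∧ C))
  ∧-assoc A B C = (λ ((a , b) , c) → a , (b , c)) , (λ (a , (b , c)) → (a , b) , c)

  ∧-superset : ∀ A T → A ⊆ₘ T → (A ∧ T) ≈ A
  ∧-superset _ _ A⊆T = proj₁ , λ a → a , A⊆T a

module Union {V : Set} {Y : Family V} (∪Y : ClosedUnder∪ Y) where
  private
    _∨_ : Member Y → Member Y → Member Y
    _∨_ = join ∪Y
    _≈_ : Member Y → Member Y → Set
    _≈_ = _≈ₘ_

  ∨-cong : ∀ P Q R S → P ≈ Q → R ≈ S → (P ∨ R) ≈ (Q ∨ S)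
  ∨-cong _ _ _ _ (P⊆Q , Q⊆P) (R⊆S , S⊆R) =
    [ inj₁ ∘ P⊆Q , inj₂ ∘ R⊆S ]′ , [ inj₁ ∘ Q⊆P , inj₂ ∘ S⊆R ]′

  ∨-idem : ∀ P → (P ∨ P) ≈ P
  ∨-idem P = [ id , id ]′ , inj₁

  ∨-comm : ∀ P Q → (P ∨ Q) ≈ (Q ∨ P)
  ∨-comm P Q = swap , swap

  ∨-assoc : ∀ P Q R → ((P ∨ Q) ∨ R) ≈ (P ∨ (Q ∨ R))
  ∨-assoc P Q R =
    [ [ inj₁ , (λ q → inj₂ (inj₁ q)) ]′ , (λ r → inj₂ (inj₂ r)) ]′ ,
    [ (λ p → inj₁ (inj₁ p)) , [ (λ q → inj₁ (inj₂ q)) , inj₂ ]′ ]′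

  ∨-subset : ∀ P S → S ⊆ₘ P → (P ∨ S) ≈ P
  ∨-subset _ _ S⊆P = [ id , S⊆P ]′ , inj₁

-- An inverse between families of sets, with the members passed explicitly:
-- equality of members only constrains their underlying sets, so Agda cannot
-- infer the members themselves from an equation between them.
module MemberInverse {U V : Set} {X : Family U} {Y : Family V}
    (θ : Inverse (MemberSetoid X) (MemberSetoid Y)) where
  open Inverse θ public using (to; from; strictlyInverseˡ; strictlyInverseʳ)

  to-cong : ∀ A B → _≈ₘ_ {F = X} A B → _≈ₘ_ {F = Y} (to A) (to B)
  to-cong _ _ = Inverse.to-cong θ

  from-cong : ∀ P Q → _≈ₘ_ {F = Y} P Q → _≈ₘ_ {F = X} (from P) (from Q)
  from-cong _ _ = Inverse.from-cong θ

module TransportedJoin {U V : Set} {X : Family U} {Y : Family V}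
    (∩X : ClosedUnder∩ X) (∪Y : ClosedUnder∪ Y)
    (θ : Inverse (MemberSetoid X) (MemberSetoid Y)) where
  private
    module θ = MemberInverse θ
    _∧_ : Member X → Member X → Member X
    _∧_ = meet ∩X
    _∨_ : Member Y → Member Y → Member Y
    _∨_ = join ∪Y
    _≈_ : Member X → Member X → Set
    _≈_ = _≈ₘ_
  open Union {Y = Y} ∪Y

  _⊕_ : Member X → Member X → Member X
  A ⊕ B = θ.from (θ.to A ∨ θ.to B)

  ⊕-cong : ∀ A B C D → A ≈ B → C ≈ D → (A ⊕ C) ≈ (B ⊕ D)
  ⊕-cong A B C D A≈B C≈D = θ.from-cong (θ.to A ∨ θ.to C) (θ.to B ∨ θ.to D)
    (∨-cong (θ.to A) (θ.to B) (θ.to C) (θ.to D) (θ.to-cong A B A≈B) (θ.to-cong C D C≈D))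

  ⊕-idem : ∀ A → (A ⊕ A) ≈ A
  ⊕-idem A = ≐-trans (θ.from-cong (θ.to A ∨ θ.to A) (θ.to A) (∨-idem (θ.to A))) (θ.strictlyInverseʳ A)

  ⊕-comm : ∀ A B → (A ⊕ B) ≈ (B ⊕ A)
  ⊕-comm A B = θ.from-cong (θ.to A ∨ θ.to B) (θ.to B ∨ θ.to A) (∨-comm (θ.to A) (θ.to B))

  ⊕-assoc : ∀ A B C → ((A ⊕ B) ⊕ C) ≈ (A ⊕ (B ⊕ C))
  ⊕-assoc A B C = begin
    θ.from (θ.to (θ.from (a ∨ b)) ∨ c)  ≈⟨ θ.from-cong (θ.to (θ.from (a ∨ b)) ∨ c) ((a ∨ b) ∨ c) (∨-cong (θ.to (θ.from (a ∨ b))) (a ∨ b) c c (θ.strictlyInverseˡ (a ∨ b)) ≐-refl) ⟩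
    θ.from ((a ∨ b) ∨ c)                 ≈⟨ θ.from-cong ((a ∨ b) ∨ c) (a ∨ (b ∨ c)) (∨-assoc a b c) ⟩
    θ.from (a ∨ (b ∨ c))                 ≈⟨ θ.from-cong (a ∨ θ.to (θ.from (b ∨ c))) (a ∨ (b ∨ c)) (∨-cong a a (θ.to (θ.from (b ∨ c))) (b ∨ c) ≐-refl (θ.strictlyInverseˡ (b ∨ c))) ⟨
    θ.from (a ∨ θ.to (θ.from (b ∨ c)))  ∎
    where
    open SetoidReasoning (MemberSetoid X)
    a = θ.to A
    b = θ.to B
    c = θ.to C

  ⊕-identity : ∀ {o} (o-least : IsLeast Y o) A → (A ⊕ θ.from (o , proj₁ o-least)) ≈ A
  ⊕-identity {o} (o∈Y , o-below) A = begin
    θ.from (a ∨ θ.to (θ.from ō))  ≈⟨ θ.from-cong (a ∨ θ.to (θ.from ō)) (a ∨ ō) (∨-cong a a (θ.to (θ.from ō)) ō ≐-refl (θ.strictlyInverseˡ ō)) ⟩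
    θ.from (a ∨ ō)                ≈⟨ θ.from-cong (a ∨ ō) a (∨-subset a ō (o-below (proj₂ a))) ⟩
    θ.from a                      ≈⟨ θ.strictlyInverseʳ A ⟩
    A                             ∎
    where
    open SetoidReasoning (MemberSetoid X)
    a = θ.to A
    ō = (o , o∈Y)

  ⊕-distrib-∧ :
    (∀ P Q R → _≈ₘ_ {F = Y} (P ∨ θ.to (θ.from Q ∧ θ.from R))
                            (θ.to (θ.from (P ∨ Q) ∧ θ.from (P ∨ R)))) →
    ∀ A B C → (A ⊕ (B ∧ C)) ≈ ((A ⊕ B) ∧ (A ⊕ C))
  ⊕-distrib-∧ ∪-distrib A B C = begin
    θ.from (a ∨ θ.to (B ∧ C))          ≈⟨ θ.from-cong (a ∨ θ.to (B ∧ C)) (a ∨ θ.to B∧C′) (∨-cong a a (θ.to (B ∧ C)) (θ.to B∧C′) ≐-refl (θ.to-cong (B ∧ C) B∧C′ B∧C≈B∧C′)) ⟩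
    θ.from (a ∨ θ.to B∧C′)             ≈⟨ θ.from-cong (a ∨ θ.to B∧C′) (θ.to D) (∪-distrib a (θ.to B) (θ.to C)) ⟩
    θ.from (θ.to D)                    ≈⟨ θ.strictlyInverseʳ D ⟩
    D                                  ∎
    where
    open SetoidReasoning (MemberSetoid X)
    a = θ.to A
    -- B ∧ C written through θ⁻¹ θ, as it appears in the hypothesis
    B∧C′ = θ.from (θ.to B) ∧ θ.from (θ.to C)
    D = (A ⊕ B) ∧ (A ⊕ C)
    B∧C≈B∧C′ : (B ∧ C) ≈ B∧C′
    B∧C≈B∧C′ = Intersection.∧-cong {X = X} ∩X B (θ.from (θ.to B)) C (θ.from (θ.to C)) (≐-sym (θ.strictlyInverseʳ B)) (≐-sym (θ.strictlyInverseʳ C))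

module AntitoneIsomorphism {U V : Set} {X : Family U} {Y : Family V}
    (∩X : ClosedUnder∩ X) (∪Y : ClosedUnder∪ Y)
    (star : Inverse (MemberSetoid Y) (MemberSetoid X))
    (antitone : ∀ P Q → (_⊆ₘ_ {F = Y} P Q → _⊆ₘ_ {F = X} (Inverse.to star Q) (Inverse.to star P))
      × (_⊆ₘ_ {F = X} (Inverse.to star Q) (Inverse.to star P) → _⊆ₘ_ {F = Y} P Q)) where
  private
    module ⋆ = MemberInverse star
    _∧_ : Member X → Member X → Member X
    _∧_ = meet ∩X
    _∨_ : Member Y → Member Y → Member Y
    _∨_ = join ∪Y

  adjunction : ∀ P A → A ⊆ₘ ⋆.to P → P ⊆ₘ ⋆.from A
  adjunction P A A⊆P⋆ = proj₂ (antitone P (⋆.from A)) (A⊆P⋆ ∘ proj₁ (⋆.strictlyInverseˡ A))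

  star-∪ : ∀ P Q → _≈ₘ_ {F = X} (⋆.to (P ∨ Q)) (⋆.to P ∧ ⋆.to Q)
  star-∪ P Q = (λ z → proj₁ (antitone P (P ∨ Q)) inj₁ z , proj₁ (antitone Q (P ∨ Q)) inj₂ z)
             , proj₁ (antitone (P ∨ Q) (⋆.from Z)) [ P⊆Z⋆⁻¹ , Q⊆Z⋆⁻¹ ]′ ∘ proj₂ (⋆.strictlyInverseˡ Z)
    where
    Z = ⋆.to P ∧ ⋆.to Q
    P⊆Z⋆⁻¹ : P ⊆ₘ ⋆.from Z
    P⊆Z⋆⁻¹ = adjunction P Z proj₁
    Q⊆Z⋆⁻¹ : Q ⊆ₘ ⋆.from Z
    Q⊆Z⋆⁻¹ = adjunction Q Z proj₂

  -- Obtained from star-∪ by writing A and B as ⋆-images.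
  unstar-∩ : ∀ A B → _≈ₘ_ {F = Y} (⋆.from (A ∧ B)) (⋆.from A ∨ ⋆.from B)
  unstar-∩ A B = begin
    ⋆.from (A ∧ B)           ≈⟨ ⋆.from-cong (A ∧ B) (⋆.to a ∧ ⋆.to b) A∧B≈ ⟩
    ⋆.from (⋆.to a ∧ ⋆.to b) ≈⟨ ⋆.from-cong (⋆.to (a ∨ b)) (⋆.to a ∧ ⋆.to b) (star-∪ a b) ⟨
    ⋆.from (⋆.to (a ∨ b))    ≈⟨ ⋆.strictlyInverseʳ (a ∨ b) ⟩
    a ∨ b                    ∎
    where
    open SetoidReasoning (MemberSetoid Y)
    a = ⋆.from A
    b = ⋆.from B
    A∧B≈ : _≈ₘ_ {F = X} (A ∧ B) (⋆.to a ∧ ⋆.to b)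
    A∧B≈ = Intersection.∧-cong {X = X} ∩X A (⋆.to a) B (⋆.to b)
             (≐-sym (⋆.strictlyInverseˡ A)) (≐-sym (⋆.strictlyInverseˡ B))

  star-least-greatest : ∀ {o} (o-least : IsLeast Y o) A → A ⊆ₘ ⋆.to (o , proj₁ o-least)
  star-least-greatest {o} (o∈Y , o-below) A =
    proj₁ (antitone (o , o∈Y) (⋆.from A)) (o-below (proj₂ (⋆.from A)))
      ∘ proj₂ (⋆.strictlyInverseˡ A)

-- Its key consequence θ (A†) = A⋆⁻¹ makes † an involution, and together with
-- the behaviour of ⋆ on unions and intersections yields the De Morgan laws
-- with respect to ∩ and the transported join ⊕.
module Dagger {U V : Set} {X : Family U} {Y : Family V}
    (∩X : ClosedUnder∩ X) (∪Y : ClosedUnder∪ Y)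
    (θ : Inverse (MemberSetoid X) (MemberSetoid Y))
    (star : Inverse (MemberSetoid Y) (MemberSetoid X))
    (antitone : ∀ P Q → (_⊆ₘ_ {F = Y} P Q → _⊆ₘ_ {F = X} (Inverse.to star Q) (Inverse.to star P))
      × (_⊆ₘ_ {F = X} (Inverse.to star Q) (Inverse.to star P) → _⊆ₘ_ {F = Y} P Q))
    (compatible : ∀ A → _≈ₘ_ {F = X} (Inverse.to star (Inverse.to θ A))
                                     (Inverse.from θ (Inverse.from star A))) where
  private
    module θ = MemberInverse θ
    module ⋆ = MemberInverse star
    _∧_ : Member X → Member X → Member X
    _∧_ = meet ∩X
    _∨_ : Member Y → Member Y → Member Y
    _∨_ = join ∪Y
    _≈_ : Member X → Member X → Set
    _≈_ = _≈ₘ_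
  open Union {Y = Y} ∪Y using (∨-cong)
  open TransportedJoin ∩X ∪Y θ using (_⊕_)
  open AntitoneIsomorphism ∩X ∪Y star antitone using (star-∪; unstar-∩)

  _† : Member X → Member X
  A † = ⋆.to (θ.to A)

  †-cong : ∀ A B → A ≈ B → (A †) ≈ (B †)
  †-cong A B A≈B = ⋆.to-cong (θ.to A) (θ.to B) (θ.to-cong A B A≈B)

  θ-† : ∀ A → _≈ₘ_ {F = Y} (θ.to (A †)) (⋆.from A)
  θ-† A = ≐-trans (θ.to-cong (A †) (θ.from (⋆.from A)) (compatible A))
                  (θ.strictlyInverseˡ (⋆.from A))

  †-involutive : ∀ A → ((A †) †) ≈ A
  †-involutive A = ≐-trans (⋆.to-cong (θ.to (A †)) (⋆.from A) (θ-† A)) (⋆.strictlyInverseˡ A)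

  †-deMorgan-∧ : ∀ A B → ((A ∧ B) †) ≈ ((A †) ⊕ (B †))
  †-deMorgan-∧ A B = begin
    (A ∧ B) †                       ≈⟨ compatible (A ∧ B) ⟩
    θ.from (⋆.from (A ∧ B))         ≈⟨ θ.from-cong (⋆.from (A ∧ B)) (a ∨ b) (unstar-∩ A B) ⟩
    θ.from (a ∨ b)                  ≈⟨ θ.from-cong (θ.to (A †) ∨ θ.to (B †)) (a ∨ b) θ-†-both ⟨
    θ.from (θ.to (A †) ∨ θ.to (B †)) ∎
    where
    open SetoidReasoning (MemberSetoid X)
    a = ⋆.from A
    b = ⋆.from B
    θ-†-both : _≈ₘ_ {F = Y} (θ.to (A †) ∨ θ.to (B †)) (a ∨ b)
    θ-†-both = ∨-cong (θ.to (A †)) a (θ.to (B †)) b (θ-† A) (θ-† B)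

  †-deMorgan-⊕ : ∀ A B → ((A ⊕ B) †) ≈ ((A †) ∧ (B †))
  †-deMorgan-⊕ A B =
    ≐-trans (⋆.to-cong (θ.to (θ.from P)) P (θ.strictlyInverseˡ P)) (star-∪ (θ.to A) (θ.to B))
    where
    P = θ.to A ∨ θ.to B

lemma4p1 : {U V : Set} (X : Family U) (Y : Family V)
  (∩X : ClosedUnder∩ X) (∪Y : ClosedUnder∪ Y)
  (o : Pred V 0ℓ) (o-least : IsLeast Y o)
  (θ : Inverse (MemberSetoid X) (MemberSetoid Y)) →
  (∀ A B C → _≈ₘ_ {F = X} (meet ∩X A (Inverse.from θ (join ∪Y (Inverse.to θ B) (Inverse.to θ C))))
      (Inverse.from θ (join ∪Y (Inverse.to θ (meet ∩X A B)) (Inverse.to θ (meet ∩X A C))))) →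
  (∀ P Q R → _≈ₘ_ {F = Y} (join ∪Y P (Inverse.to θ (meet ∩X (Inverse.from θ Q) (Inverse.from θ R))))
      (Inverse.to θ (meet ∩X (Inverse.from θ (join ∪Y P Q)) (Inverse.from θ (join ∪Y P R))))) →
  (star : Inverse (MemberSetoid Y) (MemberSetoid X)) →
  (∀ P Q → (_⊆ₘ_ {F = Y} P Q → _⊆ₘ_ {F = X} (Inverse.to star Q) (Inverse.to star P))
    × (_⊆ₘ_ {F = X} (Inverse.to star Q) (Inverse.to star P) → _⊆ₘ_ {F = Y} P Q)) →
  (∀ A → _≈ₘ_ {F = X} (Inverse.to star (Inverse.to θ A)) (Inverse.from θ (Inverse.from star A))) →
  IsDeMorganBisemilattice (_≈ₘ_ {F = X})
    (meet ∩X)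
    (λ A B → Inverse.from θ (join ∪Y (Inverse.to θ A) (Inverse.to θ B)))
    (λ A → Inverse.to star (Inverse.to θ A))
    (Inverse.from θ (o , proj₁ o-least))
    (Inverse.to star (o , proj₁ o-least))
lemma4p1 X Y ∩X ∪Y o o-least θ meet-distrib join-distrib star antitone compatible = record
  { isEquivalence = Setoid.isEquivalence (MemberSetoid X)
  ; ∧-cong        = λ {A} {B} {C} {D} → ∧-cong A B C D
  ; ∨-cong        = λ {A} {B} {C} {D} → ⊕-cong A B C D
  ; ′-cong        = λ {A} {B} → †-cong A B
  ; ∧-idem        = ∧-idem
  ; ∨-idem        = ⊕-idem
  ; ∧-comm        = ∧-comm
  ; ∨-comm        = ⊕-comm
  ; ∧-assoc       = ∧-assoc
  ; ∨-assoc       = ⊕-assoc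
  ; ∧-distrib-∨   = meet-distrib
  ; ∨-distrib-∧   = ⊕-distrib-∧ join-distrib
  ; ∧-identity    = λ A → ∧-superset A ⊤ (star-least-greatest o-least A)
  ; ∨-identity    = ⊕-identity o-least
  ; ′-involutive  = †-involutive
  ; deMorgan-∧    = †-deMorgan-∧
  ; deMorgan-∨    = †-deMorgan-⊕
  }
  where
  open Intersection {X = X} ∩X
  open TransportedJoin ∩X ∪Y θ
  open AntitoneIsomorphism ∩X ∪Y star antitone using (star-least-greatest)
  open Dagger ∩X ∪Y θ star antitone compatible
  -- the top element 0̄⋆, greatest because ⋆ reverses inclusion
  ⊤ : Member X
  ⊤ = Inverse.to star (o , proj₁ o-least)
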